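{- For integers $m\ge1$, $n\ge0$ and $k$, $$\binom{n}{k}^{*}_{2m}=\sum_{i=0}^n\binom ni\binom{n}{k-(m+1)i}_m.$$
   Context: $\binom{n}{k}^{*}_{2m}:=[u^k](1+u+\dots+u^{m-1}+u^{m+1}+\dots+u^{2m})^n$ (mock-$m$-nomial coefficient) and $\binom{n}{K}_m:=[u^K](1+u+\dots+u^{m-1})^n$ ($m$-nomial coefficient, $0$ for $K<0$ or $K>(m-1)n$). -}

module Defs where

open import Data.Nat using (ℕ; zero; suc; _+_; _*_)
open import Data.Integer using (ℤ; +_; -[1+_])
open import Data.List using (List; []; _∷_; map; replicate; _++_; sum; upTo)

-- Polynomials in u with ℕ coefficients, as coefficient lists (constant term first).
Poly : Set
Poly = List ℕ

_⊕_ : Poly → Poly → Poly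
[]       ⊕ q        = q
(a ∷ p)  ⊕ []       = a ∷ p
(a ∷ p)  ⊕ (b ∷ q)  = (a + b) ∷ (p ⊕ q)

_⊗_ : Poly → Poly → Poly
[]      ⊗ q = []
(a ∷ p) ⊗ q = map (a *_) q ⊕ (0 ∷ (p ⊗ q))

_^ᵖ_ : Poly → ℕ → Poly
p ^ᵖ zero    = 1 ∷ []
p ^ᵖ (suc n) = p ⊗ (p ^ᵖ n)

coeffℕ : Poly → ℕ → ℕ
coeffℕ []      _       = 0
coeffℕ (a ∷ p) zero    = a
coeffℕ (a ∷ p) (suc k) = coeffℕ p k

coeff : Poly → ℤ → ℕ
coeff p (+ k)    = coeffℕ p k
coeff p -[1+ _ ] = 0

mnomialPoly : ℕ → Poly
mnomialPoly m = replicate m 1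

-- 1 + u + ... + u^(m-1) + u^(m+1) + ... + u^(2m)   (u^m omitted)
mockPoly : ℕ → Poly
mockPoly m = replicate m 1 ++ (0 ∷ replicate m 1)

mnomial : ℕ → ℕ → ℤ → ℕ
mnomial m n K = coeff (mnomialPoly m ^ᵖ n) K

mock : ℕ → ℕ → ℤ → ℕ
mock m n k = coeff (mockPoly m ^ᵖ n) k

module Submission where

-- Write M = 1 + u + … + u^(m-1).  Omitting u^m from
-- 1 + u + … + u^(2m) leaves the mock polynomial M + u^(m+1)·M, hence
--   mock^n = (1 + u^(m+1))^n · M^n = Σ_i C(n,i) · u^((m+1)i) · M^n,
-- and reading off the coefficient of u^k gives the theorem.

open import Defs
open import Data.Nat using (ℕ; _≥_; zero; suc) renaming (_+_ to _+ℕ_; _*_ to _*ℕ_)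
open import Data.Nat.Combinatorics using (_C_; nCk+nC[k+1]≡[n+1]C[k+1]; k>n⇒nCk≡0)
open import Data.Nat.ListAction using (sum)
open import Data.Integer using (ℤ; +_; -[1+_]; _-_; _*_) renaming (_+_ to _+ℤ_; _⊖_ to _ℤ⊖_)
open import Data.List using ([]; _∷_; map; replicate; _++_; applyUpTo; upTo)
open import Relation.Binary.PropositionalEquality
  using (_≡_; refl; sym; trans; cong; cong₂; module ≡-Reasoning)
open import Function using (_∘_)
import Data.Nat.Properties as ℕP
import Data.Integer.Properties as ℤP
import Data.Nat.Tactic.RingSolver as ℕSolver
import Data.Integer.Tactic.RingSolver as ℤSolver

open ≡-Reasoning

-- Coefficientwise equality of polynomials: equality of the represented
-- polynomials, insensitive to trailing zeros.
infix 4 _≈_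
record _≈_ (p q : Poly) : Set where
  constructor mk≈
  field at : ∀ j → coeffℕ p j ≡ coeffℕ q j
open _≈_

≈-refl : ∀ {p} → p ≈ p
≈-refl = mk≈ λ _ → refl

≡⇒≈ : ∀ {p q} → p ≡ q → p ≈ q
≡⇒≈ refl = ≈-refl

≈-trans : ∀ {p q r} → p ≈ q → q ≈ r → p ≈ r
≈-trans e f = mk≈ λ j → trans (at e j) (at f j)

∷-resp : ∀ a {p q} → p ≈ q → (a ∷ p) ≈ (a ∷ q)
∷-resp a e = mk≈ λ { zero → refl ; (suc j) → at e j }

coeffℕ-⊕ : ∀ p q j → coeffℕ (p ⊕ q) j ≡ coeffℕ p j +ℕ coeffℕ q j
coeffℕ-⊕ []      q       j       = refl
coeffℕ-⊕ (a ∷ p) []      j       = sym (ℕP.+-identityʳ _)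
coeffℕ-⊕ (a ∷ p) (b ∷ q) zero    = refl
coeffℕ-⊕ (a ∷ p) (b ∷ q) (suc j) = coeffℕ-⊕ p q j

coeffℕ-scale : ∀ a q j → coeffℕ (map (a *ℕ_) q) j ≡ a *ℕ coeffℕ q j
coeffℕ-scale a []      j       = sym (ℕP.*-zeroʳ a)
coeffℕ-scale a (b ∷ q) zero    = refl
coeffℕ-scale a (b ∷ q) (suc j) = coeffℕ-scale a q j

⊕-resp : ∀ {p p′ q q′} → p ≈ p′ → q ≈ q′ → (p ⊕ q) ≈ (p′ ⊕ q′)
⊕-resp {p} {p′} {q} {q′} e f = mk≈ λ j → begin
  coeffℕ (p ⊕ q) j              ≡⟨ coeffℕ-⊕ p q j ⟩
  coeffℕ p j +ℕ coeffℕ q j      ≡⟨ cong₂ _+ℕ_ (at e j) (at f j) ⟩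
  coeffℕ p′ j +ℕ coeffℕ q′ j    ≡⟨ coeffℕ-⊕ p′ q′ j ⟨
  coeffℕ (p′ ⊕ q′) j            ∎

⊕-interchange : ∀ p q r s → ((p ⊕ q) ⊕ (r ⊕ s)) ≈ ((p ⊕ r) ⊕ (q ⊕ s))
⊕-interchange p q r s = mk≈ λ j → begin
  coeffℕ ((p ⊕ q) ⊕ (r ⊕ s)) j
    ≡⟨ expand p q r s j ⟩
  (coeffℕ p j +ℕ coeffℕ q j) +ℕ (coeffℕ r j +ℕ coeffℕ s j)
    ≡⟨ swap (coeffℕ p j) (coeffℕ q j) (coeffℕ r j) (coeffℕ s j) ⟩
  (coeffℕ p j +ℕ coeffℕ r j) +ℕ (coeffℕ q j +ℕ coeffℕ s j)
    ≡⟨ expand p r q s j ⟨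
  coeffℕ ((p ⊕ r) ⊕ (q ⊕ s)) j ∎
  where
  expand : ∀ p q r s j → coeffℕ ((p ⊕ q) ⊕ (r ⊕ s)) j
                       ≡ (coeffℕ p j +ℕ coeffℕ q j) +ℕ (coeffℕ r j +ℕ coeffℕ s j)
  expand p q r s j = trans (coeffℕ-⊕ (p ⊕ q) (r ⊕ s) j)
                           (cong₂ _+ℕ_ (coeffℕ-⊕ p q j) (coeffℕ-⊕ r s j))
  swap : ∀ a b c d → (a +ℕ b) +ℕ (c +ℕ d) ≡ (a +ℕ c) +ℕ (b +ℕ d)
  swap = ℕSolver.solve-∀

scale-+ : ∀ a b r → map ((a +ℕ b) *ℕ_) r ≈ (map (a *ℕ_) r ⊕ map (b *ℕ_) r)
scale-+ a b r = mk≈ λ j → begin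
  coeffℕ (map ((a +ℕ b) *ℕ_) r) j                  ≡⟨ coeffℕ-scale (a +ℕ b) r j ⟩
  (a +ℕ b) *ℕ coeffℕ r j                           ≡⟨ ℕP.*-distribʳ-+ (coeffℕ r j) a b ⟩
  a *ℕ coeffℕ r j +ℕ b *ℕ coeffℕ r j               ≡⟨ cong₂ _+ℕ_ (coeffℕ-scale a r j) (coeffℕ-scale b r j) ⟨
  coeffℕ (map (a *ℕ_) r) j +ℕ coeffℕ (map (b *ℕ_) r) j ≡⟨ coeffℕ-⊕ (map (a *ℕ_) r) (map (b *ℕ_) r) j ⟨
  coeffℕ (map (a *ℕ_) r ⊕ map (b *ℕ_) r) j         ∎

scale-⊕ : ∀ a q r → map (a *ℕ_) (q ⊕ r) ≈ (map (a *ℕ_) q ⊕ map (a *ℕ_) r)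
scale-⊕ a q r = mk≈ λ j → begin
  coeffℕ (map (a *ℕ_) (q ⊕ r)) j                   ≡⟨ coeffℕ-scale a (q ⊕ r) j ⟩
  a *ℕ coeffℕ (q ⊕ r) j                            ≡⟨ cong (a *ℕ_) (coeffℕ-⊕ q r j) ⟩
  a *ℕ (coeffℕ q j +ℕ coeffℕ r j)                  ≡⟨ ℕP.*-distribˡ-+ a (coeffℕ q j) (coeffℕ r j) ⟩
  a *ℕ coeffℕ q j +ℕ a *ℕ coeffℕ r j               ≡⟨ cong₂ _+ℕ_ (coeffℕ-scale a q j) (coeffℕ-scale a r j) ⟨
  coeffℕ (map (a *ℕ_) q) j +ℕ coeffℕ (map (a *ℕ_) r) j ≡⟨ coeffℕ-⊕ (map (a *ℕ_) q) (map (a *ℕ_) r) j ⟨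
  coeffℕ (map (a *ℕ_) q ⊕ map (a *ℕ_) r) j         ∎

scale-resp : ∀ a {q q′} → q ≈ q′ → map (a *ℕ_) q ≈ map (a *ℕ_) q′
scale-resp a {q} {q′} e = mk≈ λ j →
  trans (coeffℕ-scale a q j) (trans (cong (a *ℕ_) (at e j)) (sym (coeffℕ-scale a q′ j)))

⊗-respʳ : ∀ p {q q′} → q ≈ q′ → (p ⊗ q) ≈ (p ⊗ q′)
⊗-respʳ []      e = ≈-refl
⊗-respʳ (a ∷ p) e = ⊕-resp (scale-resp a e) (∷-resp 0 (⊗-respʳ p e))

-- The two distributive laws.  Note that (0 ∷ x) ⊕ (0 ∷ y) is 0 ∷ (x ⊕ y)
-- by computation, so each inductive step is one interchange.
⊗-distribʳ-⊕ : ∀ p q r → ((p ⊕ q) ⊗ r) ≈ ((p ⊗ r) ⊕ (q ⊗ r))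
⊗-distribʳ-⊕ []      q       r = ≈-refl
⊗-distribʳ-⊕ (a ∷ p) []      r = mk≈ λ j → sym (trans (coeffℕ-⊕ ((a ∷ p) ⊗ r) [] j) (ℕP.+-identityʳ _))
⊗-distribʳ-⊕ (a ∷ p) (b ∷ q) r =
  ≈-trans (⊕-resp (scale-+ a b r) (∷-resp 0 (⊗-distribʳ-⊕ p q r)))
          (⊕-interchange (map (a *ℕ_) r) (map (b *ℕ_) r) (0 ∷ (p ⊗ r)) (0 ∷ (q ⊗ r)))

⊗-distribˡ-⊕ : ∀ p q r → (p ⊗ (q ⊕ r)) ≈ ((p ⊗ q) ⊕ (p ⊗ r))
⊗-distribˡ-⊕ []      q r = ≈-refl
⊗-distribˡ-⊕ (a ∷ p) q r =
  ≈-trans (⊕-resp (scale-⊕ a q r) (∷-resp 0 (⊗-distribˡ-⊕ p q r)))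
          (⊕-interchange (map (a *ℕ_) q) (map (a *ℕ_) r) (0 ∷ (p ⊗ q)) (0 ∷ (p ⊗ r)))

shiftN : ℕ → Poly → Poly
shiftN zero    p = p
shiftN (suc s) p = 0 ∷ shiftN s p

shiftN-resp : ∀ s {p q} → p ≈ q → shiftN s p ≈ shiftN s q
shiftN-resp zero    e = e
shiftN-resp (suc s) e = ∷-resp 0 (shiftN-resp s e)

-- u·p·r = u·(p·r), on either side.  For the right-hand version the constant
-- term is a·0 + 0 = 0 and the tail is a·q + p·(u·q), handled by induction.
u⊗ : ∀ p r → ((0 ∷ p) ⊗ r) ≈ (0 ∷ (p ⊗ r))
u⊗ p r = mk≈ λ j → trans (coeffℕ-⊕ (map (0 *ℕ_) r) (0 ∷ (p ⊗ r)) j)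
                         (cong (_+ℕ coeffℕ (0 ∷ (p ⊗ r)) j) (coeffℕ-scale 0 r j))

⊗u : ∀ p q → (p ⊗ (0 ∷ q)) ≈ (0 ∷ (p ⊗ q))
⊗u []      q = mk≈ λ { zero → refl ; (suc j) → refl }
⊗u (a ∷ p) q = mk≈ λ
  { zero    → trans (ℕP.+-identityʳ (a *ℕ 0)) (ℕP.*-zeroʳ a)
  ; (suc j) → at (⊕-resp (≈-refl {map (a *ℕ_) q}) (⊗u p q)) j }

shiftN-⊗ : ∀ s p r → (shiftN s p ⊗ r) ≈ shiftN s (p ⊗ r)
shiftN-⊗ zero    p r = ≈-refl
shiftN-⊗ (suc s) p r = ≈-trans (u⊗ (shiftN s p) r) (∷-resp 0 (shiftN-⊗ s p r))

⊗-shiftN : ∀ s p q → (p ⊗ shiftN s q) ≈ shiftN s (p ⊗ q)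
⊗-shiftN zero    p q = ≈-refl
⊗-shiftN (suc s) p q = ≈-trans (⊗u p (shiftN s q)) (∷-resp 0 (⊗-shiftN s p q))

-- T s n B = (1 + u^s)^n · B, defined by peeling off one factor at a time.
T : ℕ → ℕ → Poly → Poly
T s zero    B = B
T s (suc n) B = T s n B ⊕ shiftN s (T s n B)

⊗-T : ∀ s n A B → (A ⊗ T s n B) ≈ T s n (A ⊗ B)
⊗-T s zero    A B = ≈-refl
⊗-T s (suc n) A B =
  ≈-trans (⊗-distribˡ-⊕ A (T s n B) (shiftN s (T s n B)))
          (⊕-resp (⊗-T s n A B)
                  (≈-trans (⊗-shiftN s A (T s n B)) (shiftN-resp s (⊗-T s n A B))))

ones-++ : ∀ m X → replicate m 1 ++ X ≡ replicate m 1 ⊕ shiftN m X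
ones-++ zero    X = refl
ones-++ (suc m) X = cong (1 ∷_) (ones-++ m X)

mock-split : ∀ m → mockPoly m ≡ mnomialPoly m ⊕ shiftN (m +ℕ 1) (mnomialPoly m)
mock-split m = trans (ones-++ m (0 ∷ replicate m 1)) (cong (replicate m 1 ⊕_) (shift-suc m))
  where
  shift-suc : ∀ s → shiftN s (0 ∷ replicate m 1) ≡ shiftN (s +ℕ 1) (replicate m 1)
  shift-suc zero    = refl
  shift-suc (suc s) = cong (0 ∷_) (shift-suc s)

mock-power : ∀ m n → (mockPoly m ^ᵖ n) ≈ T (m +ℕ 1) n (mnomialPoly m ^ᵖ n)
mock-power m zero    = ≈-refl
mock-power m (suc n) =
  ≈-trans (⊗-respʳ (mockPoly m) (mock-power m n))
  (≈-trans (≡⇒≈ (cong (_⊗ X) (mock-split m)))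
  (≈-trans (⊗-distribʳ-⊕ M (shiftN s M) X)
           (⊕-resp (⊗-T s n M (M ^ᵖ n))
                   (≈-trans (shiftN-⊗ s M X) (shiftN-resp s (⊗-T s n M (M ^ᵖ n)))))))
  where
  s = m +ℕ 1
  M = mnomialPoly m
  X = T s n (M ^ᵖ n)

coeff-resp : ∀ {p q} → p ≈ q → ∀ k → coeff p k ≡ coeff q k
coeff-resp e (+ j)    = at e j
coeff-resp e -[1+ _ ] = refl

coeff-⊕ : ∀ p q k → coeff (p ⊕ q) k ≡ coeff p k +ℕ coeff q k
coeff-⊕ p q (+ j)    = coeffℕ-⊕ p q j
coeff-⊕ p q -[1+ _ ] = refl

coeff-shiftN : ∀ s X k → coeff (shiftN s X) k ≡ coeff X (k - + s)
coeff-shiftN zero    X k            = cong (coeff X) (sym (ℤP.+-identityʳ k))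
coeff-shiftN (suc s) X -[1+ _ ]     = refl
coeff-shiftN (suc s) X (+ zero)     = refl
coeff-shiftN (suc s) X (+ (suc j))  = trans (coeff-shiftN s X (+ j)) (cong (coeff X) (begin
  + j - + s              ≡⟨ ℤP.m-n≡m⊖n j s ⟩
  j ℤ⊖ s                 ≡⟨ ℤP.[1+m]⊖[1+n]≡m⊖n j s ⟨
  suc j ℤ⊖ suc s         ≡⟨ ℤP.m-n≡m⊖n (suc j) (suc s) ⟨
  + suc j - + suc s      ∎))

Σ< : ℕ → (ℕ → ℕ) → ℕ
Σ< zero    f = 0
Σ< (suc n) f = f 0 +ℕ Σ< n (f ∘ suc)

sum-applyUpTo : ∀ n (f g : ℕ → ℕ) → sum (map f (applyUpTo g n)) ≡ Σ< n (f ∘ g)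
sum-applyUpTo zero    f g = refl
sum-applyUpTo (suc n) f g = cong (f (g 0) +ℕ_) (sum-applyUpTo n f (g ∘ suc))

Σ<-cong : ∀ n {f g : ℕ → ℕ} → (∀ i → f i ≡ g i) → Σ< n f ≡ Σ< n g
Σ<-cong zero    e = refl
Σ<-cong (suc n) e = cong₂ _+ℕ_ (e 0) (Σ<-cong n (e ∘ suc))

Σ<-+ : ∀ n (f g : ℕ → ℕ) → Σ< n (λ i → f i +ℕ g i) ≡ Σ< n f +ℕ Σ< n g
Σ<-+ zero    f g = refl
Σ<-+ (suc n) f g =
  trans (cong (f 0 +ℕ g 0 +ℕ_) (Σ<-+ n (f ∘ suc) (g ∘ suc))) (swap (f 0) (g 0) _ _)
  where
  swap : ∀ a b c d → a +ℕ b +ℕ (c +ℕ d) ≡ (a +ℕ c) +ℕ (b +ℕ d)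
  swap = ℕSolver.solve-∀

Σ<-last : ∀ n (f : ℕ → ℕ) → Σ< (suc n) f ≡ Σ< n f +ℕ f n
Σ<-last zero    f = ℕP.+-comm (f 0) 0
Σ<-last (suc n) f = trans (cong (f 0 +ℕ_) (Σ<-last n (f ∘ suc))) (sym (ℕP.+-assoc (f 0) _ _))

binomSum : ℕ → (ℕ → ℕ) → ℕ
binomSum n h = Σ< (suc n) (λ i → (n C i) *ℕ h i)

binomSum-suc : ∀ n h → binomSum (suc n) h ≡ binomSum n h +ℕ binomSum n (h ∘ suc)
binomSum-suc n h = begin
  binomSum (suc n) h
    ≡⟨⟩
  1 *ℕ h 0 +ℕ Σ< (suc n) (λ i → (suc n C suc i) *ℕ h (suc i))
    ≡⟨ cong (1 *ℕ h 0 +ℕ_) (Σ<-cong (suc n) pascal) ⟩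
  1 *ℕ h 0 +ℕ Σ< (suc n) (λ i → (n C i) *ℕ h (suc i) +ℕ (n C suc i) *ℕ h (suc i))
    ≡⟨ cong (1 *ℕ h 0 +ℕ_) (Σ<-+ (suc n) (λ i → (n C i) *ℕ h (suc i)) upper) ⟩
  1 *ℕ h 0 +ℕ (binomSum n (h ∘ suc) +ℕ Σ< (suc n) upper)
    ≡⟨ cong (λ x → 1 *ℕ h 0 +ℕ (binomSum n (h ∘ suc) +ℕ x)) drop-last ⟩
  1 *ℕ h 0 +ℕ (binomSum n (h ∘ suc) +ℕ Σ< n upper)
    ≡⟨ rearrange (1 *ℕ h 0) (binomSum n (h ∘ suc)) (Σ< n upper) ⟩
  binomSum n h +ℕ binomSum n (h ∘ suc)
    ∎
  where
  upper : ℕ → ℕ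
  upper i = (n C suc i) *ℕ h (suc i)
  pascal : ∀ i → (suc n C suc i) *ℕ h (suc i) ≡ (n C i) *ℕ h (suc i) +ℕ upper i
  pascal i = trans (cong (_*ℕ h (suc i)) (sym (nCk+nC[k+1]≡[n+1]C[k+1] n i)))
                   (ℕP.*-distribʳ-+ (h (suc i)) (n C i) (n C suc i))
  -- the term i = n of 'upper' involves C(n, n+1) = 0
  drop-last : Σ< (suc n) upper ≡ Σ< n upper
  drop-last = begin
    Σ< (suc n) upper            ≡⟨ Σ<-last n upper ⟩
    Σ< n upper +ℕ upper n       ≡⟨ cong (λ c → Σ< n upper +ℕ c *ℕ h (suc n)) (k>n⇒nCk≡0 (ℕP.n<1+n n)) ⟩
    Σ< n upper +ℕ 0             ≡⟨ ℕP.+-identityʳ _ ⟩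
    Σ< n upper                  ∎
  rearrange : ∀ a b c → a +ℕ (b +ℕ c) ≡ (a +ℕ c) +ℕ b
  rearrange = ℕSolver.solve-∀

coeff-T : ∀ s n B k → coeff (T s n B) k ≡ binomSum n (λ i → coeff B (k - + s * + i))
coeff-T s zero B k = begin
  coeff B k                   ≡⟨ cong (coeff B) (sym (no-shift k (+ s))) ⟩
  coeff B (k - + s * + 0)     ≡⟨ sym (trans (ℕP.+-identityʳ _) (ℕP.+-identityʳ _)) ⟩
  binomSum 0 (λ i → coeff B (k - + s * + i)) ∎
  where
  no-shift : ∀ (k S : ℤ) → k - S * + 0 ≡ k
  no-shift = ℤSolver.solve-∀
coeff-T s (suc n) B k = begin
  coeff (T s n B ⊕ shiftN s (T s n B)) k
    ≡⟨ coeff-⊕ (T s n B) (shiftN s (T s n B)) k ⟩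
  coeff (T s n B) k +ℕ coeff (shiftN s (T s n B)) k
    ≡⟨ cong (coeff (T s n B) k +ℕ_) (coeff-shiftN s (T s n B) k) ⟩
  coeff (T s n B) k +ℕ coeff (T s n B) (k - + s)
    ≡⟨ cong₂ _+ℕ_ (coeff-T s n B k) (coeff-T s n B (k - + s)) ⟩
  binomSum n h +ℕ binomSum n (λ i → coeff B ((k - + s) - + s * + i))
    ≡⟨ cong (binomSum n h +ℕ_) (Σ<-cong (suc n) λ i →
         cong (λ z → (n C i) *ℕ coeff B z) (sym (one-more-shift k (+ s) (+ i)))) ⟩
  binomSum n h +ℕ binomSum n (h ∘ suc)
    ≡⟨ binomSum-suc n h ⟨
  binomSum (suc n) h
    ∎
  where
  h : ℕ → ℕ
  h i = coeff B (k - + s * + i)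
  one-more-shift : ∀ (k S I : ℤ) → k - S * (+ 1 +ℤ I) ≡ (k - S) - S * I
  one-more-shift = ℤSolver.solve-∀

-- The theorem.
mainTheorem16 : (m n : ℕ) → m ≥ 1 → (k : ℤ) →
    mock m n k ≡ sum (map (λ i → (n C i) *ℕ mnomial m n (k - (+ (m +ℕ 1)) * (+ i))) (upTo (n +ℕ 1)))
mainTheorem16 m n _ k = begin
  coeff (mockPoly m ^ᵖ n) k
    ≡⟨ coeff-resp (mock-power m n) k ⟩
  coeff (T (m +ℕ 1) n (mnomialPoly m ^ᵖ n)) k
    ≡⟨ coeff-T (m +ℕ 1) n (mnomialPoly m ^ᵖ n) k ⟩
  Σ< (suc n) term
    ≡⟨ cong (λ z → Σ< z term) (ℕP.+-comm 1 n) ⟩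
  Σ< (n +ℕ 1) term
    ≡⟨ sum-applyUpTo (n +ℕ 1) term (λ i → i) ⟨
  sum (map term (upTo (n +ℕ 1)))
    ∎
  where
  term : ℕ → ℕ
  term i = (n C i) *ℕ mnomial m n (k - (+ (m +ℕ 1)) * (+ i))
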